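{- Let $\mathcal{C}$ be a pruned interpolant of an implication $A\to B$. Then there is an $\mathbf{LK}^-$ proof $\pi$ of the split sequent $A;\Rightarrow;B$ such that $\mathcal{C}$ subsumes $\mathrm{CNF}(\mathcal{M}(\pi))$.
   Context: Propositional formulas are built from atoms and $\bot$ using $\wedge,\vee,\neg$; $A\to B$ abbreviates $\neg A\vee B$; $\top$ abbreviates $\neg\bot\vee\bot$. $V(A)$ is the set of atoms of $A$. A literal is an atom (counting $\bot$ as an atom), a negated atom, or $\top$. A clause is a finite set of literals (read as disjunction), a clause set a set of clauses (read as conjunction). A clause set is pruned if no atom $p$ occurs in it both as $p$ and as $\neg p$ and it does not contain the literal $\top$. An interpolant of a valid $A\to B$ is a formula or clause set $C$ with $V(C)\subseteq V(A)\cap V(B)$ such that $A\to C$ and $C\to B$ are valid. A pruned interpolant of $A\to B$ is a pruned clause set $\mathcal{C}$ that is an interpolant of $A\to B$ such that there are no clauses $C'\subsetneq C\in\mathcal{C}$ with $A\models C'$. A clause set $\mathcal{A}$ subsumes $\mathcal{B}$ if for every $B\in\mathcal{B}$ there is $A\in\mathcal{A}$ with $A\subseteq B$. $\mathcal{C}\times\mathcal{D}=\{C\cup D\mid C\in\mathcal{C},D\in\mathcal{D}\}$; $\mathrm{CNF}$ is defined on formulas built from literals by $\wedge,\vee$: $\mathrm{CNF}(\top)=\emptyset$, $\mathrm{CNF}(\bot)=\{\emptyset\}$, $\mathrm{CNF}(\ell)=\{\{\ell\}\}$ for other literals, $\mathrm{CNF}(A\wedge B)=\mathrm{CNF}(A)\cup\mathrm{CNF}(B)$,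 $\mathrm{CNF}(A\vee B)=\mathrm{CNF}(A)\times\mathrm{CNF}(B)$. $\mathbf{LK}^-$ is the cut-free sequent calculus with axioms $p\Rightarrow p$ ($p$ an atom) and $\bot\Rightarrow$, and rules weakening, contraction, $(L\wedge_1),(L\wedge_2),(R\wedge),(R\vee_1),(R\vee_2),(L\vee),(L\neg),(R\neg)$ in standard Gentzen G1 form. A split sequent $\Gamma_1;\Gamma_2\Rightarrow\Delta_1;\Delta_2$ is the sequent $\Gamma_1,\Gamma_2\Rightarrow\Delta_1,\Delta_2$ with formulas divided into a left side ($\Gamma_1,\Delta_1$) and a right side ($\Gamma_2,\Delta_2$); in a proof of a split sequent every sequent is split, context formulas keep their side and auxiliary formulas lie on the side of the main formula. The Maehara interpolant $\mathcal{M}(\pi)$: axioms $p;\Rightarrow p;$ give $\bot$, $;p\Rightarrow;p$ give $\top$, $p;\Rightarrow;p$ give $p$, $;p\Rightarrow p;$ give $\neg p$, $\bot;\Rightarrow;$ gives $\bot$, $;\bot\Rightarrow;$ gives $\top$; unary rules keep the premise's interpolant; a binary rule ($(R\wedge)$ or $(L\vee)$) with premise proofs $\pi_1,\pi_2$ gives $\mathcal{M}(\pi_1)\vee\mathcal{M}(\pi_2)$ if its main formula is on the left side and $\mathcal{M}(\pi_1)\wedge\mathcal{M}(\pi_2)$ if on the right side. -}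

module Defs where

open import Data.Nat using (ℕ)
open import Data.Bool using (Bool; true; false; not; _∧_; _∨_)
open import Data.List using (List; []; _∷_; _++_; map; concatMap; [_])
open import Data.List.Membership.Propositional using (_∈_)
open import Data.List.Relation.Binary.Subset.Propositional using (_⊆_)
open import Data.List.Relation.Binary.Permutation.Propositional using (_↭_)
open import Data.Product using (_×_; Σ; ∃; ∃-syntax; _,_)
open import Relation.Nullary using (¬_)
open import Relation.Binary.PropositionalEquality using (_≡_)

infixr 6 _∧'_
infixr 5 _∨'_

data Fm : Set where
  var  : ℕ → Fm
  ⊥'   : Fm
  _∧'_ : Fm → Fm → Fm
  _∨'_ : Fm → Fm → Fm
  ¬'_  : Fm → Fm

Valuation : Set
Valuation = ℕ → Bool

⟦_⟧ : Fm → Valuation → Bool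
⟦ var p ⟧ v = v p
⟦ ⊥' ⟧ v = false
⟦ A ∧' B ⟧ v = ⟦ A ⟧ v ∧ ⟦ B ⟧ v
⟦ A ∨' B ⟧ v = ⟦ A ⟧ v ∨ ⟦ B ⟧ v
⟦ ¬' A ⟧ v = not (⟦ A ⟧ v)

V : Fm → List ℕ
V (var p) = p ∷ []
V ⊥' = []
V (A ∧' B) = V A ++ V B
V (A ∨' B) = V A ++ V B
V (¬' A) = V A

data Atom : Set where
  avar : ℕ → Atom
  abot : Atom

data Literal : Set where
  pos : Atom → Literal
  neg : Atom → Literal
  top : Literal

Clause : Set
Clause = List Literal          -- finite set of literals (set semantics via ∈)

ClauseSet : Set
ClauseSet = List Clause        -- finite set of clauses (set semantics via ∈)

⟦_⟧a : Atom → Valuation → Bool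
⟦ avar p ⟧a v = v p
⟦ abot ⟧a v = false

⟦_⟧l : Literal → Valuation → Bool
⟦ pos a ⟧l v = ⟦ a ⟧a v
⟦ neg a ⟧l v = not (⟦ a ⟧a v)
⟦ top ⟧l v = true

⟦_⟧c : Clause → Valuation → Bool
⟦ [] ⟧c v = false
⟦ l ∷ C ⟧c v = ⟦ l ⟧l v ∨ ⟦ C ⟧c v

⟦_⟧cs : ClauseSet → Valuation → Bool
⟦ [] ⟧cs v = true
⟦ C ∷ 𝒞 ⟧cs v = ⟦ C ⟧c v ∧ ⟦ 𝒞 ⟧cs v

atomVars : Atom → List ℕ
atomVars (avar p) = p ∷ []
atomVars abot = []

litVars : Literal → List ℕ
litVars (pos a) = atomVars a
litVars (neg a) = atomVars a
litVars top = []

clauseVars : Clause → List ℕ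
clauseVars = concatMap litVars

csVars : ClauseSet → List ℕ
csVars = concatMap clauseVars

_⊨c_ : Fm → Clause → Set
A ⊨c C = ∀ v → ⟦ A ⟧ v ≡ true → ⟦ C ⟧c v ≡ true

ValidImp : Fm → Fm → Set
ValidImp A B = ∀ v → ⟦ A ⟧ v ≡ true → ⟦ B ⟧ v ≡ true

OccursIn : Literal → ClauseSet → Set
OccursIn l 𝒞 = ∃[ C ] (C ∈ 𝒞 × l ∈ C)

Pruned : ClauseSet → Set
Pruned 𝒞 = (∀ a → ¬ (OccursIn (pos a) 𝒞 × OccursIn (neg a) 𝒞)) × ¬ OccursIn top 𝒞

Interpolant : ClauseSet → Fm → Fm → Set
Interpolant 𝒞 A B =
  (∀ p → p ∈ csVars 𝒞 → (p ∈ V A) × (p ∈ V B)) ×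
  (∀ v → ⟦ A ⟧ v ≡ true → ⟦ 𝒞 ⟧cs v ≡ true) ×
  (∀ v → ⟦ 𝒞 ⟧cs v ≡ true → ⟦ B ⟧ v ≡ true)

_⊂_ : Clause → Clause → Set
C' ⊂ C = C' ⊆ C × ¬ (C ⊆ C')

PrunedInterpolant : ClauseSet → Fm → Fm → Set
PrunedInterpolant 𝒞 A B =
  Pruned 𝒞 × Interpolant 𝒞 A B ×
  (∀ C C' → C ∈ 𝒞 → C' ⊂ C → ¬ (A ⊨c C'))

Subsumes : ClauseSet → ClauseSet → Set
Subsumes 𝒜 ℬ = ∀ B → B ∈ ℬ → ∃[ A ] (A ∈ 𝒜 × A ⊆ B)

data LFm : Set where
  lit  : Literal → LFm
  _⋀_  : LFm → LFm → LFm
  _⋁_  : LFm → LFm → LFm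

_×cs_ : ClauseSet → ClauseSet → ClauseSet
𝒞 ×cs 𝒟 = concatMap (λ C → map (λ D → C ++ D) 𝒟) 𝒞

CNF : LFm → ClauseSet
CNF (lit top) = []
CNF (lit (pos abot)) = [] ∷ []
CNF (lit l) = (l ∷ []) ∷ []
CNF (A ⋀ B) = CNF A ++ CNF B
CNF (A ⋁ B) = CNF A ×cs CNF B

data Side : Set where
  left right : Side

record SSeq : Set where
  constructor ⟨_⨾_⇒_⨾_⟩
  field
    Γ₁ Γ₂ Δ₁ Δ₂ : List Fm
open SSeq public

addL : Side → Fm → SSeq → SSeq
addL left  A ⟨ Γ₁ ⨾ Γ₂ ⇒ Δ₁ ⨾ Δ₂ ⟩ = ⟨ A ∷ Γ₁ ⨾ Γ₂ ⇒ Δ₁ ⨾ Δ₂ ⟩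
addL right A ⟨ Γ₁ ⨾ Γ₂ ⇒ Δ₁ ⨾ Δ₂ ⟩ = ⟨ Γ₁ ⨾ A ∷ Γ₂ ⇒ Δ₁ ⨾ Δ₂ ⟩

addR : Side → Fm → SSeq → SSeq
addR left  A ⟨ Γ₁ ⨾ Γ₂ ⇒ Δ₁ ⨾ Δ₂ ⟩ = ⟨ Γ₁ ⨾ Γ₂ ⇒ A ∷ Δ₁ ⨾ Δ₂ ⟩
addR right A ⟨ Γ₁ ⨾ Γ₂ ⇒ Δ₁ ⨾ Δ₂ ⟩ = ⟨ Γ₁ ⨾ Γ₂ ⇒ Δ₁ ⨾ A ∷ Δ₂ ⟩

empty : SSeq
empty = ⟨ [] ⨾ [] ⇒ [] ⨾ [] ⟩

-- sequents are multisets: equality up to permutation of each of the four parts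
_≈s_ : SSeq → SSeq → Set
S ≈s T = (Γ₁ S ↭ Γ₁ T) × (Γ₂ S ↭ Γ₂ T) × (Δ₁ S ↭ Δ₁ T) × (Δ₂ S ↭ Δ₂ T)

-- Proofs of split sequents in LK⁻ (G1 style, shared contexts, no cut).
-- Auxiliary formulas always lie on the side of the main formula;
-- context formulas keep their side.
data Proof : SSeq → Set where
  ax    : (s t : Side) (p : ℕ) → Proof (addL s (var p) (addR t (var p) empty))
  ax⊥   : (s : Side) → Proof (addL s ⊥' empty)
  exch  : ∀ {S T} → S ≈s T → Proof S → Proof T
  wL    : ∀ {S} s A → Proof S → Proof (addL s A S)
  wR    : ∀ {S} s A → Proof S → Proof (addR s A S)
  cL    : ∀ {S} s A → Proof (addL s A (addL s A S)) → Proof (addL s A S)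
  cR    : ∀ {S} s A → Proof (addR s A (addR s A S)) → Proof (addR s A S)
  L∧₁   : ∀ {S} s A B → Proof (addL s A S) → Proof (addL s (A ∧' B) S)
  L∧₂   : ∀ {S} s A B → Proof (addL s B S) → Proof (addL s (A ∧' B) S)
  R∧    : ∀ {S} s A B → Proof (addR s A S) → Proof (addR s B S) → Proof (addR s (A ∧' B) S)
  R∨₁   : ∀ {S} s A B → Proof (addR s A S) → Proof (addR s (A ∨' B) S)
  R∨₂   : ∀ {S} s A B → Proof (addR s B S) → Proof (addR s (A ∨' B) S)
  L∨    : ∀ {S} s A B → Proof (addL s A S) → Proof (addL s B S) → Proof (addL s (A ∨' B) S)
  L¬    : ∀ {S} s A → Proof (addR s A S) → Proof (addL s (¬' A) S)
  R¬    : ∀ {S} s A → Proof (addL s A S) → Proof (addR s (¬' A) S)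

binop : Side → LFm → LFm → LFm
binop left  X Y = X ⋁ Y
binop right X Y = X ⋀ Y

ℳ : ∀ {S} → Proof S → LFm
ℳ (ax left  left  p) = lit (pos abot)
ℳ (ax right right p) = lit top
ℳ (ax left  right p) = lit (pos (avar p))
ℳ (ax right left  p) = lit (neg (avar p))
ℳ (ax⊥ left)  = lit (pos abot)
ℳ (ax⊥ right) = lit top
ℳ (exch _ π) = ℳ π
ℳ (wL _ _ π) = ℳ π
ℳ (wR _ _ π) = ℳ π
ℳ (cL _ _ π) = ℳ π
ℳ (cR _ _ π) = ℳ π
ℳ (L∧₁ _ _ _ π) = ℳ π
ℳ (L∧₂ _ _ _ π) = ℳ π
ℳ (R∧ s _ _ π₁ π₂) = binop s (ℳ π₁) (ℳ π₂)
ℳ (R∨₁ _ _ _ π) = ℳ π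
ℳ (R∨₂ _ _ _ π) = ℳ π
ℳ (L∨ s _ _ π₁ π₂) = binop s (ℳ π₁) (ℳ π₂)
ℳ (L¬ _ _ π) = ℳ π
ℳ (R¬ _ _ π) = ℳ π

{-# OPTIONS --safe #-}
module Submission where

-- Decompose B on the right side by the invertible rules of LK⁻, keeping A ; ⇒ on the left.
-- Right-side binary rules combine interpolants by ∧, so the CNF of the final interpolant is
-- the union of the CNFs at the leaves A ; Λ ⇒ ; Π, where Λ, Π are atoms and 𝒞 ∧ Λ ⊨ Π.
-- As 𝒞 has no complementary pair, such a leaf is an axiom (interpolant ⊤) or some clause C
-- of 𝒞 is refuted by Λ ⇒ Π: its negative atoms lie in Λ and its positive ones in Π. Then
-- decompose A on the left side of A ; Λ_C ⇒ ; Π_C, where Λ_C and Π_C are the negative and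
-- positive atoms of C, and weaken to A ; Λ ⇒ ; Π. All literals of the resulting interpolant
-- come from C, so every clause K of its CNF satisfies K ⊆ C; also A ⊨ K by soundness of
-- Maehara interpolants, and minimality of C in 𝒞 forces K = C.

open import Defs
open import Data.Bool using (Bool; true; false; not; _∧_; _∨_)
open import Data.Bool.Properties using (∨-zeroʳ) renaming (_≟_ to _≟ᵇ_)
open import Data.Empty using (⊥; ⊥-elim)
open import Data.List using (List; []; _∷_; _++_; [_]; concatMap)
open import Data.List.Properties using (++-assoc; ++-identityʳ)
open import Data.List.Membership.Propositional using (_∈_; _∉_; find; lose)
open import Data.List.Membership.Propositional.Properties using (∈-++⁻; ∈-++⁺ʳ; ∈-∃++)
open import Data.List.Relation.Binary.Subset.Propositional using (_⊆_)
open import Data.List.Relation.Binary.Subset.Propositional.Properties using (⊆-refl; ∈-∷⁺ʳ)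
open import Data.List.Relation.Binary.Permutation.Propositional using (_↭_; ↭-refl; ↭-sym; ↭-reflexive; prep; swap)
open import Data.List.Relation.Binary.Permutation.Propositional.Properties
  using (shift; ++-comm; ∷↭∷ʳ; All-resp-↭; Any-resp-↭)
open import Data.List.Relation.Unary.All as All using (All; []; _∷_)
import Data.List.Relation.Unary.All.Properties as All
open import Data.List.Relation.Unary.Any as Any using (Any; here; there; any?)
import Data.List.Relation.Unary.Any.Properties as Any
open import Data.Nat as ℕ using (ℕ)
open import Data.Product using (Σ; ∃-syntax; _×_; _,_; proj₁; proj₂)
open import Data.Sum as Sum using (_⊎_; inj₁; inj₂)
open import Data.Unit using (⊤; tt)
open import Function using (_∘_; id; case_of_)
open import Relation.Binary.Definitions using (DecidableEquality)
open import Relation.Binary.PropositionalEquality using (_≡_; refl; sym; cong; subst₂)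
open import Relation.Nullary using (¬_; Dec; yes; no; does)
open import Relation.Nullary.Decidable using (map′; dec-true; dec-false; _⊎-dec_; _×-dec_; ¬?)

⟦_⟧ᴸ : LFm → Valuation → Bool
⟦ lit l ⟧ᴸ v = ⟦ l ⟧l v
⟦ M ⋀ N ⟧ᴸ v = ⟦ M ⟧ᴸ v ∧ ⟦ N ⟧ᴸ v
⟦ M ⋁ N ⟧ᴸ v = ⟦ M ⟧ᴸ v ∨ ⟦ N ⟧ᴸ v

Holds : Valuation → Fm → Set
Holds v X = ⟦ X ⟧ v ≡ true

LitHolds : Valuation → Literal → Set
LitHolds v l = ⟦ l ⟧l v ≡ true

Valid : (Valuation → Set) → List Fm → List Fm → Set
Valid Hyp Γ Δ = ∀ v → Hyp v → All (Holds v) Γ → Any (Holds v) Δ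

∧-true⁺ : ∀ {x y} → x ≡ true → y ≡ true → x ∧ y ≡ true
∧-true⁺ refl refl = refl

∧-true⁻ : ∀ {x y} → x ∧ y ≡ true → x ≡ true × y ≡ true
∧-true⁻ {true} {true} refl = refl , refl

∨-trueˡ : ∀ {x y} → x ≡ true → x ∨ y ≡ true
∨-trueˡ refl = refl

∨-trueʳ : ∀ {x y} → y ≡ true → x ∨ y ≡ true
∨-trueʳ {x} refl = ∨-zeroʳ x

∨-true⁻ : ∀ {x y} → x ∨ y ≡ true → x ≡ true ⊎ y ≡ true
∨-true⁻ {true} _ = inj₁ refl
∨-true⁻ {false} h = inj₂ h

⊎-∧-true : ∀ {A : Set} {x y} → A ⊎ x ≡ true → A ⊎ y ≡ true → A ⊎ x ∧ y ≡ true
⊎-∧-true (inj₁ a) _ = inj₁ a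
⊎-∧-true _ (inj₁ a) = inj₁ a
⊎-∧-true (inj₂ x) (inj₂ y) = inj₂ (∧-true⁺ x y)

not-true : ∀ {x} → x ≡ true → not x ≡ true → ⊥
not-true refl ()

witness : ∀ {P : Set} (P? : Dec P) → does P? ≡ true → P
witness (yes p) _ = p
witness (no _) ()

Any-head : ∀ {A : Set} {P : A → Set} {x y xs} → (P x → P y) → Any P (x ∷ xs) → Any P (y ∷ xs)
Any-head f (here p) = here (f p)
Any-head f (there q) = there q

clause-true⁺ : ∀ {v} C → Any (LitHolds v) C → ⟦ C ⟧c v ≡ true
clause-true⁺ (_ ∷ _) (here h) = ∨-trueˡ h
clause-true⁺ (_ ∷ C) (there h) = ∨-trueʳ (clause-true⁺ C h)

clause-true⁻ : ∀ {v} C → ⟦ C ⟧c v ≡ true → Any (LitHolds v) C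
clause-true⁻ (_ ∷ C) h with ∨-true⁻ h
... | inj₁ hl = here hl
... | inj₂ hC = there (clause-true⁻ C hC)

clauses-true⁺ : ∀ {v} 𝒞 → All (λ C → ⟦ C ⟧c v ≡ true) 𝒞 → ⟦ 𝒞 ⟧cs v ≡ true
clauses-true⁺ [] [] = refl
clauses-true⁺ (_ ∷ 𝒞) (h ∷ hs) = ∧-true⁺ h (clauses-true⁺ 𝒞 hs)

clauses-true⁻ : ∀ {v} 𝒞 → ⟦ 𝒞 ⟧cs v ≡ true → All (λ C → ⟦ C ⟧c v ≡ true) 𝒞
clauses-true⁻ [] _ = []
clauses-true⁻ (_ ∷ 𝒞) h = proj₁ (∧-true⁻ h) ∷ clauses-true⁻ 𝒞 (proj₂ (∧-true⁻ h))

All-×cs⁺ : ∀ {P : Clause → Set} 𝒞 𝒟 → (∀ {C D} → C ∈ 𝒞 → D ∈ 𝒟 → P (C ++ D)) → All P (𝒞 ×cs 𝒟)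
All-×cs⁺ [] 𝒟 pres = []
All-×cs⁺ (C ∷ 𝒞) 𝒟 pres = All.++⁺ (All.map⁺ (All.tabulate (pres (here refl)))) (All-×cs⁺ 𝒞 𝒟 (pres ∘ there))

CNF-sound : ∀ {v} M → ⟦ M ⟧ᴸ v ≡ true → All (Any (LitHolds v)) (CNF M)
CNF-sound (lit (pos (avar p))) h = here h ∷ []
CNF-sound (lit (pos abot)) ()
CNF-sound (lit (neg a)) h = here h ∷ []
CNF-sound (lit top) h = []
CNF-sound (M ⋀ N) h = All.++⁺ (CNF-sound M (proj₁ (∧-true⁻ h))) (CNF-sound N (proj₂ (∧-true⁻ h)))
CNF-sound (M ⋁ N) h with ∨-true⁻ h
... | inj₁ hM = All-×cs⁺ (CNF M) (CNF N) (λ K∈ _ → Any.++⁺ˡ (All.lookup (CNF-sound M hM) K∈))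
... | inj₂ hN = All-×cs⁺ (CNF M) (CNF N) (λ {K} _ K∈ → Any.++⁺ʳ K (All.lookup (CNF-sound N hN) K∈))

ℳ-sound : ∀ {S} (π : Proof S) v → All (Holds v) (Γ₁ S) → Any (Holds v) (Δ₁ S) ⊎ ⟦ ℳ π ⟧ᴸ v ≡ true
ℳ-sound (ax left left p) v (h ∷ []) = inj₁ (here h)
ℳ-sound (ax left right p) v (h ∷ []) = inj₂ h
ℳ-sound (ax right left p) v [] with v p in vp
... | true = inj₁ (here vp)
... | false = inj₂ refl
ℳ-sound (ax right right p) v [] = inj₂ refl
ℳ-sound (ax⊥ left) v (() ∷ [])
ℳ-sound (ax⊥ right) v [] = inj₂ refl
ℳ-sound (exch (e₁ , _ , e₃ , _) π) v h = Sum.map₁ (Any-resp-↭ e₃) (ℳ-sound π v (All-resp-↭ (↭-sym e₁) h))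
ℳ-sound (wL left _ π) v (_ ∷ h) = ℳ-sound π v h
ℳ-sound (wL right _ π) v h = ℳ-sound π v h
ℳ-sound (wR left _ π) v h = Sum.map₁ there (ℳ-sound π v h)
ℳ-sound (wR right _ π) v h = ℳ-sound π v h
ℳ-sound (cL left _ π) v (a ∷ h) = ℳ-sound π v (a ∷ a ∷ h)
ℳ-sound (cL right _ π) v h = ℳ-sound π v h
ℳ-sound (cR left _ π) v h = Sum.map₁ dedup (ℳ-sound π v h)
  where
  dedup : ∀ {P : Fm → Set} {X Δ} → Any P (X ∷ X ∷ Δ) → Any P (X ∷ Δ)
  dedup (here a) = here a
  dedup (there d) = d
ℳ-sound (cR right _ π) v h = ℳ-sound π v h
ℳ-sound (L∧₁ left _ _ π) v (ab ∷ h) = ℳ-sound π v (proj₁ (∧-true⁻ ab) ∷ h)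
ℳ-sound (L∧₁ right _ _ π) v h = ℳ-sound π v h
ℳ-sound (L∧₂ left _ _ π) v (ab ∷ h) = ℳ-sound π v (proj₂ (∧-true⁻ ab) ∷ h)
ℳ-sound (L∧₂ right _ _ π) v h = ℳ-sound π v h
ℳ-sound (R∧ left _ _ π₁ π₂) v h = either (ℳ-sound π₁ v h) (ℳ-sound π₂ v h)
  where
  either : ∀ {A B Δ m₁ m₂} → Any (Holds v) (A ∷ Δ) ⊎ m₁ ≡ true → Any (Holds v) (B ∷ Δ) ⊎ m₂ ≡ true →
           Any (Holds v) (A ∧' B ∷ Δ) ⊎ m₁ ∨ m₂ ≡ true
  either (inj₂ m) _ = inj₂ (∨-trueˡ m)
  either _ (inj₂ m) = inj₂ (∨-trueʳ m)
  either (inj₁ (there d)) _ = inj₁ (there d)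
  either _ (inj₁ (there d)) = inj₁ (there d)
  either (inj₁ (here a)) (inj₁ (here b)) = inj₁ (here (∧-true⁺ a b))
ℳ-sound (R∧ right _ _ π₁ π₂) v h = ⊎-∧-true (ℳ-sound π₁ v h) (ℳ-sound π₂ v h)
ℳ-sound (R∨₁ left _ _ π) v h = Sum.map₁ (Any-head ∨-trueˡ) (ℳ-sound π v h)
ℳ-sound (R∨₁ right _ _ π) v h = ℳ-sound π v h
ℳ-sound (R∨₂ left _ _ π) v h = Sum.map₁ (Any-head ∨-trueʳ) (ℳ-sound π v h)
ℳ-sound (R∨₂ right _ _ π) v h = ℳ-sound π v h
ℳ-sound (L∨ left _ _ π₁ π₂) v (ab ∷ h) with ∨-true⁻ ab
... | inj₁ a = Sum.map₂ ∨-trueˡ (ℳ-sound π₁ v (a ∷ h))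
... | inj₂ b = Sum.map₂ ∨-trueʳ (ℳ-sound π₂ v (b ∷ h))
ℳ-sound (L∨ right _ _ π₁ π₂) v h = ⊎-∧-true (ℳ-sound π₁ v h) (ℳ-sound π₂ v h)
ℳ-sound (L¬ left _ π) v (¬x ∷ h) with ℳ-sound π v h
... | inj₁ (here x) = ⊥-elim (not-true x ¬x)
... | inj₁ (there d) = inj₁ d
... | inj₂ m = inj₂ m
ℳ-sound (L¬ right _ π) v h = ℳ-sound π v h
ℳ-sound (R¬ left X π) v h with ⟦ X ⟧ v in x
... | true = Sum.map₁ there (ℳ-sound π v (x ∷ h))
... | false = inj₁ (here (cong not x))
ℳ-sound (R¬ right _ π) v h = ℳ-sound π v h

module _ {A : Set} (F : List A → Set)
         (weakening : ∀ {x xs} → F xs → F (x ∷ xs))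
         (contraction : ∀ {x xs} → F (x ∷ x ∷ xs) → F (x ∷ xs))
         (exchange : ∀ {xs ys} → xs ↭ ys → F xs → F ys)
         where

  private
    weaken-++ : ∀ ys {xs} → F xs → F (ys ++ xs)
    weaken-++ [] f = f
    weaken-++ (_ ∷ ys) f = weakening (weaken-++ ys f)

    contract-∈ : ∀ {x xs} → x ∈ xs → F (x ∷ xs) → F xs
    contract-∈ {x} x∈ f with as , bs , refl ← ∈-∃++ x∈ =
      exchange (↭-sym (shift x as bs)) (contraction (exchange (prep x (shift x as bs)) f))

    contract-⊆ : ∀ {xs ys} → xs ⊆ ys → F (xs ++ ys) → F ys
    contract-⊆ {[]} _ f = f
    contract-⊆ {_ ∷ xs} sub f = contract-⊆ (sub ∘ there) (contract-∈ (∈-++⁺ʳ xs (sub (here refl))) f)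

  ⊆-closed : ∀ {xs ys} → xs ⊆ ys → F xs → F ys
  ⊆-closed {xs} {ys} sub = contract-⊆ sub ∘ exchange (++-comm ys xs) ∘ weaken-++ ys

ProofSatisfying : (LFm → Set) → SSeq → Set
ProofSatisfying Q S = Σ (Proof S) (λ π → Q (ℳ π))

data Part : Set where
  antecedent succedent : Side → Part

replace : Part → List Fm → SSeq → SSeq
replace (antecedent left) Γ S = record S { Γ₁ = Γ }
replace (antecedent right) Γ S = record S { Γ₂ = Γ }
replace (succedent left) Δ S = record S { Δ₁ = Δ }
replace (succedent right) Δ S = record S { Δ₂ = Δ }

module _ {Q : LFm → Set} where

  private
    weakening : ∀ P {S X Γ} → ProofSatisfying Q (replace P Γ S) → ProofSatisfying Q (replace P (X ∷ Γ) S)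
    weakening (antecedent left) (π , q) = wL left _ π , q
    weakening (antecedent right) (π , q) = wL right _ π , q
    weakening (succedent left) (π , q) = wR left _ π , q
    weakening (succedent right) (π , q) = wR right _ π , q

    contraction : ∀ P {S X Γ} → ProofSatisfying Q (replace P (X ∷ X ∷ Γ) S) → ProofSatisfying Q (replace P (X ∷ Γ) S)
    contraction (antecedent left) (π , q) = cL left _ π , q
    contraction (antecedent right) (π , q) = cL right _ π , q
    contraction (succedent left) (π , q) = cR left _ π , q
    contraction (succedent right) (π , q) = cR right _ π , q

    exchange : ∀ P {S Γ Γ′} → Γ ↭ Γ′ → ProofSatisfying Q (replace P Γ S) → ProofSatisfying Q (replace P Γ′ S)
    exchange (antecedent left) e (π , q) = exch (e , ↭-refl , ↭-refl , ↭-refl) π , q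
    exchange (antecedent right) e (π , q) = exch (↭-refl , e , ↭-refl , ↭-refl) π , q
    exchange (succedent left) e (π , q) = exch (↭-refl , ↭-refl , e , ↭-refl) π , q
    exchange (succedent right) e (π , q) = exch (↭-refl , ↭-refl , ↭-refl , e) π , q

  replace-⊆ : ∀ P S {Γ Γ′} → Γ ⊆ Γ′ → ProofSatisfying Q (replace P Γ S) → ProofSatisfying Q (replace P Γ′ S)
  replace-⊆ P S = ⊆-closed (λ Γ → ProofSatisfying Q (replace P Γ S)) (weakening P) (contraction P) (exchange P)

_⊑_ : SSeq → SSeq → Set
S ⊑ T = Γ₁ S ⊆ Γ₁ T × Γ₂ S ⊆ Γ₂ T × Δ₁ S ⊆ Δ₁ T × Δ₂ S ⊆ Δ₂ T

weaken : ∀ {Q S T} → S ⊑ T → ProofSatisfying Q S → ProofSatisfying Q T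
weaken {Q} {S} {T} (g₁ , g₂ , d₁ , d₂) =
    replace-⊆ {Q} (succedent right) T d₂
  ∘ replace-⊆ {Q} (succedent left) (record T { Δ₂ = Δ₂ S }) d₁
  ∘ replace-⊆ {Q} (antecedent right) (record S { Γ₁ = Γ₁ T }) g₂
  ∘ replace-⊆ {Q} (antecedent left) S g₁

singleton-⊆ : ∀ {A : Set} {x : A} {xs} → x ∈ xs → [ x ] ⊆ xs
singleton-⊆ x∈ = ∈-∷⁺ʳ x∈ (λ ())

[]⊆ : ∀ {A : Set} {xs : List A} → [] ⊆ xs
[]⊆ ()

ante succ : Side → SSeq → List Fm
ante left = Γ₁
ante right = Γ₂
succ left = Δ₁
succ right = Δ₂

axiom-within : ∀ Q {T} s t {p} → var p ∈ ante s T → var p ∈ succ t T → Q (ℳ (ax s t p)) → ProofSatisfying Q T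
axiom-within Q left left x y q = weaken {Q} (singleton-⊆ x , []⊆ , singleton-⊆ y , []⊆) (ax left left _ , q)
axiom-within Q left right x y q = weaken {Q} (singleton-⊆ x , []⊆ , []⊆ , singleton-⊆ y) (ax left right _ , q)
axiom-within Q right left x y q = weaken {Q} ([]⊆ , singleton-⊆ x , singleton-⊆ y , []⊆) (ax right left _ , q)
axiom-within Q right right x y q = weaken {Q} ([]⊆ , singleton-⊆ x , []⊆ , singleton-⊆ y) (ax right right _ , q)

axiom⊥-within : ∀ Q {T} s → ⊥' ∈ ante s T → Q (ℳ (ax⊥ s)) → ProofSatisfying Q T
axiom⊥-within Q left x q = weaken {Q} (singleton-⊆ x , []⊆ , []⊆ , []⊆) (ax⊥ left , q)
axiom⊥-within Q right x q = weaken {Q} ([]⊆ , singleton-⊆ x , []⊆ , []⊆) (ax⊥ right , q)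

data IsAtom : Fm → Set where
  atom-var : ∀ p → IsAtom (var p)
  atom-⊥ : IsAtom ⊥'

Atomic : List Fm → Set
Atomic = All IsAtom

module _ {Hyp : Valuation → Set} where

  valid-∧ˡ : ∀ {X Y Γ Δ} → Valid Hyp (X ∧' Y ∷ Γ) Δ → Valid Hyp (X ∷ Y ∷ Γ) Δ
  valid-∧ˡ val v h (x ∷ y ∷ g) = val v h (∧-true⁺ x y ∷ g)

  valid-∨ˡ₁ : ∀ {X Y Γ Δ} → Valid Hyp ((X ∨' Y) ∷ Γ) Δ → Valid Hyp (X ∷ Γ) Δ
  valid-∨ˡ₁ val v h (x ∷ g) = val v h (∨-trueˡ x ∷ g)

  valid-∨ˡ₂ : ∀ {X Y Γ Δ} → Valid Hyp ((X ∨' Y) ∷ Γ) Δ → Valid Hyp (Y ∷ Γ) Δ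
  valid-∨ˡ₂ val v h (y ∷ g) = val v h (∨-trueʳ y ∷ g)

  valid-¬ˡ : ∀ {X Γ Δ} → Valid Hyp (¬' X ∷ Γ) Δ → Valid Hyp Γ (X ∷ Δ)
  valid-¬ˡ {X} val v h g with ⟦ X ⟧ v in x
  ... | true = here x
  ... | false = there (val v h (cong not x ∷ g))

  valid-∧ʳ₁ : ∀ {X Y Γ Δ} → Valid Hyp Γ (X ∧' Y ∷ Δ) → Valid Hyp Γ (X ∷ Δ)
  valid-∧ʳ₁ val v h g = Any-head (proj₁ ∘ ∧-true⁻) (val v h g)

  valid-∧ʳ₂ : ∀ {X Y Γ Δ} → Valid Hyp Γ (X ∧' Y ∷ Δ) → Valid Hyp Γ (Y ∷ Δ)
  valid-∧ʳ₂ val v h g = Any-head (proj₂ ∘ ∧-true⁻) (val v h g)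

  valid-∨ʳ : ∀ {X Y Γ Δ} → Valid Hyp Γ ((X ∨' Y) ∷ Δ) → Valid Hyp Γ (X ∷ Y ∷ Δ)
  valid-∨ʳ val v h g with val v h g
  ... | there d = there (there d)
  ... | here xy with ∨-true⁻ xy
  ...   | inj₁ x = here x
  ...   | inj₂ y = there (here y)

  valid-¬ʳ : ∀ {X Γ Δ} → Valid Hyp Γ (¬' X ∷ Δ) → Valid Hyp (X ∷ Γ) Δ
  valid-¬ʳ val v h (x ∷ g) with val v h g
  ... | here ¬x = ⊥-elim (not-true x ¬x)
  ... | there d = d

  valid-↭ : ∀ {Γ Γ′ Δ Δ′} → Γ ↭ Γ′ → Δ ↭ Δ′ → Valid Hyp Γ Δ → Valid Hyp Γ′ Δ′
  valid-↭ e f val v h g = Any-resp-↭ f (val v h (All-resp-↭ (↭-sym e) g))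

record RuleClosed (D : List Fm → List Fm → Set) : Set where
  field
    ∧ˡ : ∀ {X Y Γ Δ} → D (X ∷ Y ∷ Γ) Δ → D (X ∧' Y ∷ Γ) Δ
    ∨ˡ : ∀ {X Y Γ Δ} → D (X ∷ Γ) Δ → D (Y ∷ Γ) Δ → D ((X ∨' Y) ∷ Γ) Δ
    ¬ˡ : ∀ {X Γ Δ} → D Γ (X ∷ Δ) → D (¬' X ∷ Γ) Δ
    ∧ʳ : ∀ {X Y Γ Δ} → D Γ (X ∷ Δ) → D Γ (Y ∷ Δ) → D Γ (X ∧' Y ∷ Δ)
    ∨ʳ : ∀ {X Y Γ Δ} → D Γ (X ∷ Y ∷ Δ) → D Γ ((X ∨' Y) ∷ Δ)
    ¬ʳ : ∀ {X Γ Δ} → D (X ∷ Γ) Δ → D Γ (¬' X ∷ Δ)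
    ↭-closed : ∀ {Γ Γ′ Δ Δ′} → Γ ↭ Γ′ → Δ ↭ Δ′ → D Γ Δ → D Γ′ Δ′

module Decomposition {D : List Fm → List Fm → Set} (closed : RuleClosed D) {Hyp : Valuation → Set}
                     (atomic : ∀ {Λ Π} → Atomic Λ → Atomic Π → Valid Hyp Λ Π → D Λ Π) where

  open RuleClosed closed

  -- Continuations: to decompose X ∧ Y on the left, decompose X and then Y at each of the
  -- atomic leaves of X; passing that work on as an argument keeps the recursion structural.
  Extensible : List Fm → List Fm → Set
  Extensible Γ Δ = ∀ {Λ Π} → Atomic Λ → Atomic Π → Valid Hyp (Γ ++ Λ) (Δ ++ Π) → D (Γ ++ Λ) (Δ ++ Π)

  private
    extend : ∀ {Γ Δ Λ Π} → Extensible Γ Δ → Atomic Λ → Atomic Π → Extensible (Γ ++ Λ) (Δ ++ Π)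
    extend {Γ} {Δ} {Λ} {Π} k aΛ aΠ {Λ′} {Π′} aΛ′ aΠ′ =
        subst₂ D (sym (++-assoc Γ Λ Λ′)) (sym (++-assoc Δ Π Π′))
      ∘ k (All.++⁺ aΛ aΛ′) (All.++⁺ aΠ aΠ′)
      ∘ subst₂ (Valid Hyp) (++-assoc Γ Λ Λ′) (++-assoc Δ Π Π′)

    atomˡ : ∀ {X Γ Δ} → IsAtom X → Extensible Γ Δ → Valid Hyp (X ∷ Γ) Δ → D (X ∷ Γ) Δ
    atomˡ {X} {Γ} {Δ} a k =
        ↭-closed (↭-sym (∷↭∷ʳ X Γ)) (↭-reflexive (++-identityʳ Δ))
      ∘ k (a ∷ []) []
      ∘ valid-↭ (∷↭∷ʳ X Γ) (↭-reflexive (sym (++-identityʳ Δ)))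

    atomʳ : ∀ {X Γ Δ} → IsAtom X → Extensible Γ Δ → Valid Hyp Γ (X ∷ Δ) → D Γ (X ∷ Δ)
    atomʳ {X} {Γ} {Δ} a k =
        ↭-closed (↭-reflexive (++-identityʳ Γ)) (↭-sym (∷↭∷ʳ X Δ))
      ∘ k [] (a ∷ [])
      ∘ valid-↭ (↭-reflexive (sym (++-identityʳ Γ))) (∷↭∷ʳ X Δ)

    decomposeˡ : ∀ X {Γ Δ} → Extensible Γ Δ → Valid Hyp (X ∷ Γ) Δ → D (X ∷ Γ) Δ
    decomposeʳ : ∀ X {Γ Δ} → Extensible Γ Δ → Valid Hyp Γ (X ∷ Δ) → D Γ (X ∷ Δ)

    decomposeˡ (var p) k = atomˡ (atom-var p) k
    decomposeˡ ⊥' k = atomˡ atom-⊥ k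
    decomposeˡ (X ∧' Y) k = ∧ˡ ∘ decomposeˡ X (λ aΛ aΠ → decomposeˡ Y (extend k aΛ aΠ)) ∘ valid-∧ˡ
    decomposeˡ (X ∨' Y) k val = ∨ˡ (decomposeˡ X k (valid-∨ˡ₁ val)) (decomposeˡ Y k (valid-∨ˡ₂ val))
    decomposeˡ (¬' X) k = ¬ˡ ∘ decomposeʳ X k ∘ valid-¬ˡ

    decomposeʳ (var p) k = atomʳ (atom-var p) k
    decomposeʳ ⊥' k = atomʳ atom-⊥ k
    decomposeʳ (X ∧' Y) k val = ∧ʳ (decomposeʳ X k (valid-∧ʳ₁ val)) (decomposeʳ Y k (valid-∧ʳ₂ val))
    decomposeʳ (X ∨' Y) k = ∨ʳ ∘ decomposeʳ X (λ aΛ aΠ → decomposeʳ Y (extend k aΛ aΠ)) ∘ valid-∨ʳ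
    decomposeʳ (¬' X) k = ¬ʳ ∘ decomposeˡ X k ∘ valid-¬ʳ

    extensible : ∀ Γ Δ → Extensible Γ Δ
    extensible [] [] = atomic
    extensible (X ∷ Γ) Δ aΛ aΠ = decomposeˡ X (extend (extensible Γ Δ) aΛ aΠ)
    extensible [] (X ∷ Δ) aΛ aΠ = decomposeʳ X (extend (extensible [] Δ) aΛ aΠ)

  decompose : ∀ Γ Δ → Valid Hyp Γ Δ → D Γ Δ
  decompose Γ Δ =
      subst₂ D (++-identityʳ Γ) (++-identityʳ Δ)
    ∘ extensible Γ Δ [] []
    ∘ subst₂ (Valid Hyp) (sym (++-identityʳ Γ)) (sym (++-identityʳ Δ))

open Decomposition using (decompose)

L∧⁺ : ∀ {S} s X Y → Proof (addL s X (addL s Y S)) → Proof (addL s (X ∧' Y) S)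
L∧⁺ s X Y π = cL s (X ∧' Y) (L∧₂ s X Y (exch (swapL s) (L∧₁ s X Y π)))
  where
  swapL : ∀ s {S} → addL s (X ∧' Y) (addL s Y S) ≈s addL s Y (addL s (X ∧' Y) S)
  swapL left = swap _ _ ↭-refl , ↭-refl , ↭-refl , ↭-refl
  swapL right = ↭-refl , swap _ _ ↭-refl , ↭-refl , ↭-refl

R∨⁺ : ∀ {S} s X Y → Proof (addR s X (addR s Y S)) → Proof (addR s (X ∨' Y) S)
R∨⁺ s X Y π = cR s (X ∨' Y) (R∨₂ s X Y (exch (swapR s) (R∨₁ s X Y π)))
  where
  swapR : ∀ s {S} → addR s (X ∨' Y) (addR s Y S) ≈s addR s Y (addR s (X ∨' Y) S)
  swapR left = ↭-refl , ↭-refl , swap _ _ ↭-refl , ↭-refl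
  swapR right = ↭-refl , ↭-refl , ↭-refl , swap _ _ ↭-refl

onSide : Side → List Fm → List Fm → List Fm → List Fm → SSeq
onSide left O₁ O₂ Γ Δ = ⟨ Γ ⨾ O₁ ⇒ Δ ⨾ O₂ ⟩
onSide right O₁ O₂ Γ Δ = ⟨ O₁ ⨾ Γ ⇒ O₂ ⨾ Δ ⟩

proofs-ruleClosed : ∀ s O₁ O₂ {Q} → (∀ M N → Q M → Q N → Q (binop s M N)) →
                    RuleClosed (λ Γ Δ → ProofSatisfying Q (onSide s O₁ O₂ Γ Δ))
proofs-ruleClosed left O₁ O₂ Q-binop = record
  { ∧ˡ = λ (π , q) → L∧⁺ left _ _ π , q
  ; ∨ˡ = λ (π₁ , q₁) (π₂ , q₂) → L∨ left _ _ π₁ π₂ , Q-binop _ _ q₁ q₂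
  ; ¬ˡ = λ (π , q) → L¬ left _ π , q
  ; ∧ʳ = λ (π₁ , q₁) (π₂ , q₂) → R∧ left _ _ π₁ π₂ , Q-binop _ _ q₁ q₂
  ; ∨ʳ = λ (π , q) → R∨⁺ left _ _ π , q
  ; ¬ʳ = λ (π , q) → R¬ left _ π , q
  ; ↭-closed = λ e f (π , q) → exch (e , ↭-refl , f , ↭-refl) π , q
  }
proofs-ruleClosed right O₁ O₂ Q-binop = record
  { ∧ˡ = λ (π , q) → L∧⁺ right _ _ π , q
  ; ∨ˡ = λ (π₁ , q₁) (π₂ , q₂) → L∨ right _ _ π₁ π₂ , Q-binop _ _ q₁ q₂
  ; ¬ˡ = λ (π , q) → L¬ right _ π , q
  ; ∧ʳ = λ (π₁ , q₁) (π₂ , q₂) → R∧ right _ _ π₁ π₂ , Q-binop _ _ q₁ q₂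
  ; ∨ʳ = λ (π , q) → R∨⁺ right _ _ π , q
  ; ¬ʳ = λ (π , q) → R¬ right _ π , q
  ; ↭-closed = λ e f (π , q) → exch (↭-refl , e , ↭-refl , f) π , q
  }

_≟ᵃ_ : DecidableEquality Atom
avar p ≟ᵃ avar q = map′ (cong avar) (λ { refl → refl }) (p ℕ.≟ q)
avar _ ≟ᵃ abot = no λ ()
abot ≟ᵃ avar _ = no λ ()
abot ≟ᵃ abot = yes refl

_≟ˡ_ : DecidableEquality Literal
pos a ≟ˡ pos b = map′ (cong pos) (λ { refl → refl }) (a ≟ᵃ b)
neg a ≟ˡ neg b = map′ (cong neg) (λ { refl → refl }) (a ≟ᵃ b)
top ≟ˡ top = yes refl
pos _ ≟ˡ neg _ = no λ ()
pos _ ≟ˡ top = no λ ()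
neg _ ≟ˡ pos _ = no λ ()
neg _ ≟ˡ top = no λ ()
top ≟ˡ pos _ = no λ ()
top ≟ˡ neg _ = no λ ()

open import Data.List.Membership.DecPropositional _≟ˡ_ using (_∈?_)

atomFm : Atom → Fm
atomFm (avar p) = var p
atomFm abot = ⊥'

atomFm-atomic : ∀ a → IsAtom (atomFm a)
atomFm-atomic (avar p) = atom-var p
atomFm-atomic abot = atom-⊥

atomFm-≟ : ∀ a X → Dec (atomFm a ≡ X)
atomFm-≟ (avar p) (var q) = map′ (cong var) (λ { refl → refl }) (p ℕ.≟ q)
atomFm-≟ abot ⊥' = yes refl
atomFm-≟ (avar _) ⊥' = no λ ()
atomFm-≟ abot (var _) = no λ ()
atomFm-≟ (avar _) (_ ∧' _) = no λ ()
atomFm-≟ abot (_ ∧' _) = no λ ()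
atomFm-≟ (avar _) (_ ∨' _) = no λ ()
atomFm-≟ abot (_ ∨' _) = no λ ()
atomFm-≟ (avar _) (¬' _) = no λ ()
atomFm-≟ abot (¬' _) = no λ ()

_∈ᵃ?_ : ∀ a Λ → Dec (atomFm a ∈ Λ)
a ∈ᵃ? Λ = any? (atomFm-≟ a) Λ

occurs? : ∀ l 𝒞 → Dec (OccursIn l 𝒞)
occurs? l 𝒞 = map′ find (λ (_ , C∈ , l∈) → lose C∈ l∈) (any? (l ∈?_) 𝒞)

-- l is false under every valuation making all of Λ true and all of Π false.
Refuted : List Fm → List Fm → Literal → Set
Refuted Λ Π (pos (avar p)) = var p ∈ Π
Refuted Λ Π (pos abot) = ⊤
Refuted Λ Π (neg a) = atomFm a ∈ Λ
Refuted Λ Π top = ⊥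

refuted? : ∀ Λ Π l → Dec (Refuted Λ Π l)
refuted? Λ Π (pos (avar p)) = avar p ∈ᵃ? Π
refuted? Λ Π (pos abot) = yes tt
refuted? Λ Π (neg a) = a ∈ᵃ? Λ
refuted? Λ Π top = no λ ()

Cross : List Fm → List Fm → Set
Cross Λ Π = ∃[ p ] (var p ∈ Λ × var p ∈ Π)

atomic-entailment : ∀ {𝒞 Λ Π} → (∀ a → ¬ (OccursIn (pos a) 𝒞 × OccursIn (neg a) 𝒞)) →
                    Atomic Λ → Atomic Π → Valid (λ v → ⟦ 𝒞 ⟧cs v ≡ true) Λ Π →
                    ⊥' ∈ Λ ⊎ Cross Λ Π ⊎ ∃[ C ] (C ∈ 𝒞 × All (Refuted Λ Π) C)
atomic-entailment {𝒞} {Λ} {Π} no-pair atΛ atΠ val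
  with abot ∈ᵃ? Λ | any? (All.all? (refuted? Λ Π)) 𝒞
... | yes ⊥∈Λ | _ = inj₁ ⊥∈Λ
... | no _ | yes refuted = inj₂ (inj₂ (find refuted))
... | no ⊥∉Λ | no unrefuted = inj₂ (inj₁ (cross (val v 𝒞-holds Λ-holds)))
  where
  -- Countermodel: Λ true, and a positive literal of 𝒞 true unless its atom is in Π. As 𝒞
  -- has no complementary pair, every unrefuted literal of 𝒞 then holds.
  Positive : ℕ → Set
  Positive p = var p ∈ Λ ⊎ (OccursIn (pos (avar p)) 𝒞 × var p ∉ Π)

  positive? : ∀ p → Dec (Positive p)
  positive? p = avar p ∈ᵃ? Λ ⊎-dec (occurs? (pos (avar p)) 𝒞 ×-dec ¬? (avar p ∈ᵃ? Π))

  v : Valuation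
  v p = does (positive? p)

  unrefuted-holds : ∀ {C l} → C ∈ 𝒞 → l ∈ C → ¬ Refuted Λ Π l → LitHolds v l
  unrefuted-holds {l = pos (avar p)} C∈ l∈ p∉Π = dec-true (positive? p) (inj₂ ((_ , C∈ , l∈) , p∉Π))
  unrefuted-holds {l = pos abot} _ _ r = ⊥-elim (r tt)
  unrefuted-holds {l = neg (avar p)} C∈ l∈ p∉Λ =
    cong not (dec-false (positive? p)
                        Sum.[ p∉Λ , (λ (pos∈ , _) → no-pair (avar p) (pos∈ , (_ , C∈ , l∈))) ])
  unrefuted-holds {l = neg abot} _ _ _ = refl
  unrefuted-holds {l = top} _ _ _ = refl

  𝒞-holds : ⟦ 𝒞 ⟧cs v ≡ true
  𝒞-holds = clauses-true⁺ 𝒞 (All.tabulate λ {C} C∈ →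
    let l , l∈ , ¬r = find (All.¬All⇒Any¬ (refuted? Λ Π) C (unrefuted ∘ lose C∈))
    in clause-true⁺ C (lose l∈ (unrefuted-holds C∈ l∈ ¬r)))

  atom-holds : ∀ {X} → IsAtom X → X ∈ Λ → Holds v X
  atom-holds (atom-var p) X∈ = dec-true (positive? p) (inj₁ X∈)
  atom-holds atom-⊥ X∈ = ⊥-elim (⊥∉Λ X∈)

  Λ-holds : All (Holds v) Λ
  Λ-holds = All.tabulate (λ X∈ → atom-holds (All.lookup atΛ X∈) X∈)

  cross : Any (Holds v) Π → Cross Λ Π
  cross holds with find holds
  ... | X , X∈ , h with All.lookup atΠ X∈
  ...   | atom-var p =
    Sum.[ (λ p∈Λ → p , p∈Λ , X∈) , (λ (_ , p∉Π) → ⊥-elim (p∉Π X∈)) ] (witness (positive? p) h)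
  ...   | atom-⊥ = case h of λ ()

negAtom posVar : Literal → List Fm
negAtom (neg a) = atomFm a ∷ []
negAtom _ = []
posVar (pos (avar p)) = var p ∷ []
posVar _ = []

negAtoms posVars : Clause → List Fm
negAtoms = concatMap negAtom
posVars = concatMap posVar

∈-negAtoms⁺ : ∀ {a C} → neg a ∈ C → atomFm a ∈ negAtoms C
∈-negAtoms⁺ l∈ = Any.concatMap⁺ negAtom (Any.map (λ { refl → here refl }) l∈)

∈-negAtoms⁻ : ∀ {X} C → X ∈ negAtoms C → ∃[ a ] (neg a ∈ C × X ≡ atomFm a)
∈-negAtoms⁻ C X∈ with find (Any.concatMap⁻ negAtom {xs = C} X∈)
... | neg a , l∈ , here refl = a , l∈ , refl

∈-posVars⁺ : ∀ {p C} → pos (avar p) ∈ C → var p ∈ posVars C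
∈-posVars⁺ l∈ = Any.concatMap⁺ posVar (Any.map (λ { refl → here refl }) l∈)

∈-posVars⁻ : ∀ {X} C → X ∈ posVars C → ∃[ p ] (pos (avar p) ∈ C × X ≡ var p)
∈-posVars⁻ C X∈ with find (Any.concatMap⁻ posVar {xs = C} X∈)
... | pos (avar p) , l∈ , here refl = p , l∈ , refl

negAtoms-atomic : ∀ C → Atomic (negAtoms C)
negAtoms-atomic C = All.tabulate λ X∈ → case ∈-negAtoms⁻ C X∈ of λ { (a , _ , refl) → atomFm-atomic a }

posVars-atomic : ∀ C → Atomic (posVars C)
posVars-atomic C = All.tabulate λ X∈ → case ∈-posVars⁻ C X∈ of λ { (p , _ , refl) → atom-var p }

refuted-negAtoms : ∀ {Λ Π C} → All (Refuted Λ Π) C → negAtoms C ⊆ Λ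
refuted-negAtoms {C = C} refuted X∈ with ∈-negAtoms⁻ C X∈
... | _ , l∈ , refl = All.lookup refuted l∈

refuted-posVars : ∀ {Λ Π C} → All (Refuted Λ Π) C → posVars C ⊆ Π
refuted-posVars {C = C} refuted X∈ with ∈-posVars⁻ C X∈
... | _ , l∈ , refl = All.lookup refuted l∈

Falsifies : List Fm → List Fm → Valuation → Set
Falsifies O₁ O₂ v = All (Holds v) O₁ × ¬ Any (Holds v) O₂

valid-++ : ∀ {O₁ O₂ Γ Δ} → Valid (Falsifies O₁ O₂) Γ Δ → ∀ v → All (Holds v) (Γ ++ O₁) → Any (Holds v) (Δ ++ O₂)
valid-++ {O₁} {O₂} {Γ} {Δ} val v h with All.++⁻ Γ h | any? (λ X → ⟦ X ⟧ v ≟ᵇ true) O₂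
... | _ , _ | yes some = Any.++⁺ʳ Δ some
... | hΓ , hO₁ | no none = Any.++⁺ˡ (val v (hO₁ , none) hΓ)

CNF-within : Clause → LFm → Set
CNF-within C M = All (_⊆ C) (CNF M)

CNF-within-⋁ : ∀ {C} M N → CNF-within C M → CNF-within C N → CNF-within C (M ⋁ N)
CNF-within-⋁ M N inM inN = All-×cs⁺ (CNF M) (CNF N) λ {K₁} K₁∈ K₂∈ l∈ →
  Sum.[ All.lookup inM K₁∈ , All.lookup inN K₂∈ ] (∈-++⁻ K₁ l∈)

var∈posVars⁻ : ∀ {p} C → var p ∈ posVars C → pos (avar p) ∈ C
var∈posVars⁻ C x∈ with ∈-posVars⁻ C x∈
... | _ , l∈ , refl = l∈

var∈negAtoms⁻ : ∀ {p} C → var p ∈ negAtoms C → neg (avar p) ∈ C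
var∈negAtoms⁻ C x∈ with ∈-negAtoms⁻ C x∈
... | avar _ , l∈ , refl = l∈

no-pair-[] : ∀ a → ¬ (OccursIn (pos a) [] × OccursIn (neg a) [])
no-pair-[] _ ((_ , () , _) , _)

clause-leaf : ∀ {C Λ Π} → Atomic Λ → Atomic Π → Valid (Falsifies (negAtoms C) (posVars C)) Λ Π →
              ProofSatisfying (CNF-within C) ⟨ Λ ⨾ negAtoms C ⇒ Π ⨾ posVars C ⟩
clause-leaf {C} {Λ} {Π} atΛ atΠ val
  with atomic-entailment no-pair-[] (All.++⁺ atΛ (negAtoms-atomic C)) (All.++⁺ atΠ (posVars-atomic C))
                         (λ v _ → valid-++ val v)
... | inj₁ ⊥∈ = Sum.[ (λ ⊥∈Λ → axiom⊥-within (CNF-within C) left ⊥∈Λ ([]⊆ ∷ []))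
                   , (λ ⊥∈C → axiom⊥-within (CNF-within C) right ⊥∈C []) ] (∈-++⁻ Λ ⊥∈)
... | inj₂ (inj₂ (_ , () , _))
... | inj₂ (inj₁ (_ , x , y)) with ∈-++⁻ Λ x | ∈-++⁻ Π y
...   | inj₁ x | inj₁ y = axiom-within (CNF-within C) left left x y ([]⊆ ∷ [])
...   | inj₁ x | inj₂ y = axiom-within (CNF-within C) left right x y (singleton-⊆ (var∈posVars⁻ C y) ∷ [])
...   | inj₂ x | inj₁ y = axiom-within (CNF-within C) right left x y (singleton-⊆ (var∈negAtoms⁻ C x) ∷ [])
...   | inj₂ x | inj₂ y = axiom-within (CNF-within C) right right x y []

clause-proof : ∀ {A C} → top ∉ C → A ⊨c C →
               ProofSatisfying (CNF-within C) ⟨ A ∷ [] ⨾ negAtoms C ⇒ [] ⨾ posVars C ⟩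
clause-proof {A} {C} top∉C A⊨C =
  decompose (proofs-ruleClosed left (negAtoms C) (posVars C) CNF-within-⋁)
            (clause-leaf {C}) (A ∷ []) [] valid
  where
  no-literal-holds : ∀ {v} → Falsifies (negAtoms C) (posVars C) v → ∃[ l ] (l ∈ C × LitHolds v l) → ⊥
  no-literal-holds (_ , ¬pos) (pos (avar p) , l∈ , h) = ¬pos (lose (∈-posVars⁺ l∈) h)
  no-literal-holds (negs , _) (neg (avar p) , l∈ , h) = not-true (All.lookup negs (∈-negAtoms⁺ l∈)) h
  no-literal-holds (negs , _) (neg abot , l∈ , _) = case All.lookup negs (∈-negAtoms⁺ l∈) of λ ()
  no-literal-holds _ (top , l∈ , _) = top∉C l∈

  valid : Valid (Falsifies (negAtoms C) (posVars C)) (A ∷ []) []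
  valid v falsifies (a ∷ []) = ⊥-elim (no-literal-holds falsifies (find (clause-true⁻ C (A⊨C v a))))

ℳ-entails-CNF : ∀ {A Γ Δ} (π : Proof ⟨ A ∷ [] ⨾ Γ ⇒ [] ⨾ Δ ⟩) {K} → K ∈ CNF (ℳ π) → A ⊨c K
ℳ-entails-CNF π {K} K∈ v a =
  clause-true⁺ K (All.lookup (CNF-sound (ℳ π) (Sum.[ (λ ()) , id ] (ℳ-sound π v (a ∷ [])))) K∈)

minimal-⊆ : ∀ {A 𝒞 C K} → (∀ C C′ → C ∈ 𝒞 → C′ ⊂ C → ¬ (A ⊨c C′)) → C ∈ 𝒞 → K ⊆ C → A ⊨c K → C ⊆ K
minimal-⊆ {K = K} minimal C∈ K⊆C A⊨K {l} l∈C with l ∈? K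
... | yes l∈K = l∈K
... | no l∉K = ⊥-elim (minimal _ _ C∈ (K⊆C , λ C⊆K → l∉K (C⊆K l∈C)) A⊨K)

subsumes-⋀ : ∀ {𝒞} M N → Subsumes 𝒞 (CNF M) → Subsumes 𝒞 (CNF N) → Subsumes 𝒞 (CNF (M ⋀ N))
subsumes-⋀ M N sM sN K K∈ = Sum.[ sM K , sN K ] (∈-++⁻ (CNF M) K∈)

pruned-leaf : ∀ {A B 𝒞 Λ Π} → PrunedInterpolant 𝒞 A B → Atomic Λ → Atomic Π →
              Valid (λ v → ⟦ 𝒞 ⟧cs v ≡ true) Λ Π →
              ProofSatisfying (Subsumes 𝒞 ∘ CNF) ⟨ A ∷ [] ⨾ Λ ⇒ [] ⨾ Π ⟩
pruned-leaf {A} {𝒞 = 𝒞} ((no-pair , top-free) , (_ , A⊨𝒞 , _) , minimal) atΛ atΠ val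
  with atomic-entailment no-pair atΛ atΠ val
... | inj₁ ⊥∈Λ = axiom⊥-within (Subsumes 𝒞 ∘ CNF) right ⊥∈Λ (λ _ ())
... | inj₂ (inj₁ (_ , x , y)) = axiom-within (Subsumes 𝒞 ∘ CNF) right right x y (λ _ ())
... | inj₂ (inj₂ (C , C∈ , refuted)) =
  weaken {Subsumes 𝒞 ∘ CNF} (⊆-refl , refuted-negAtoms refuted , []⊆ , refuted-posVars refuted)
         (subsumed (clause-proof {A} top∉C A⊨C))
  where
  top∉C : top ∉ C
  top∉C t∈ = top-free (C , C∈ , t∈)

  A⊨C : A ⊨c C
  A⊨C v a = All.lookup (clauses-true⁻ 𝒞 (A⊨𝒞 v a)) C∈

  subsumed : ∀ {Γ Δ} → ProofSatisfying (CNF-within C) ⟨ A ∷ [] ⨾ Γ ⇒ [] ⨾ Δ ⟩ →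
             ProofSatisfying (Subsumes 𝒞 ∘ CNF) ⟨ A ∷ [] ⨾ Γ ⇒ [] ⨾ Δ ⟩
  subsumed (π , within) =
    π , λ K K∈ → C , C∈ , minimal-⊆ {A} minimal C∈ (All.lookup within K∈) (ℳ-entails-CNF π K∈)

theorem5p10 : (A B : Fm) (𝒞 : ClauseSet) → ValidImp A B → PrunedInterpolant 𝒞 A B →
    Σ (Proof ⟨ A ∷ [] ⨾ [] ⇒ [] ⨾ B ∷ [] ⟩) (λ π → Subsumes 𝒞 (CNF (ℳ π)))
theorem5p10 A B 𝒞 _ pruned-interpolant@(_ , (_ , _ , 𝒞⊨B) , _) =
  decompose (proofs-ruleClosed right (A ∷ []) [] {Subsumes 𝒞 ∘ CNF} subsumes-⋀)
            (pruned-leaf {B = B} pruned-interpolant) [] (B ∷ []) (λ v 𝒞-holds _ → here (𝒞⊨B v 𝒞-holds))
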